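{- Let $G$ be a finite simple graph with a 2-cell triangulation embedding $\Pi$ in a surface $\Sigma$ of Euler genus $g\ge 1$, and let $w(G,\Pi)$ be its width. Let $C$ be a shortest noncontractible cycle of $G$ (such a cycle is chordless). Then $\mathrm{ncdist}(C)\ge w(G,\Pi)/2$.
   Context: A 2-cell triangulation embedding is an embedding in which every face is an open disk bounded by a 3-cycle. The width $w(G,\Pi)$ is the length (number of edges) of a shortest noncontractible cycle of $G$ in the embedding. For a chordless noncontractible cycle $C$ and distinct vertices $x,y\in C$, $C_{x,y}$ is the shorter of the two subpaths of $C$ joining $x$ and $y$ and $C_{y,x}$ the longer. $\mathrm{ncdist}(C)$ is the length of a shortest path $P$ that begins at some $x\in C$ and ends at some $y\in C$ such that either $x\neq y$ and both $P\cup C_{x,y}$ and $P\cup C_{y,x}$ are noncontractible cycles, or $x=y$ and $P$ is a noncontractible cycle; if no such $P$ exists, $\mathrm{ncdist}(C)=\infty$. -}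

module Defs where

open import Data.Nat using (ℕ; zero; suc; _+_; _*_; _∸_; _≤_; _<_)
open import Data.Bool using (Bool; true; false; _∧_; _∨_)
open import Data.Fin using (Fin; toℕ; _≟_)
import Data.Fin as Fin
open import Data.List using (List; []; _∷_; _++_; length; filterᵇ; allFin; cartesianProduct; lookup; take; drop; reverse)
open import Data.List.Relation.Unary.All using (All)
open import Data.List.Relation.Unary.Any using (Any)
open import Data.List.Membership.Propositional using (_∈_)
open import Data.List.Relation.Unary.Unique.Propositional using (Unique)
open import Data.Product using (Σ; ∃; _×_; _,_)
open import Data.Sum using (_⊎_)
open import Data.Unit using (⊤)
open import Data.Integer as ℤ using (ℤ; +_)
open import Relation.Nullary using (¬_)
open import Relation.Nullary.Decidable using (⌊_⌋)
open import Relation.Binary.PropositionalEquality using (_≡_; _≢_)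
open import Relation.Binary.Construct.Closure.ReflexiveTransitive using (Star)
open import Relation.Binary.Construct.Closure.Equivalence using (EqClosure)

record Graph (n : ℕ) : Set where
  field
    adj        : Fin n → Fin n → Bool
    adj-sym    : ∀ u v → adj u v ≡ adj v u
    adj-irrefl : ∀ u → adj u u ≡ false
open Graph public

Adj : ∀ {n} → Graph n → Fin n → Fin n → Set
Adj G u v = adj G u v ≡ true

edgeCount : ∀ {n} → Graph n → ℕ
edgeCount {n} G = length (filterᵇ ok (cartesianProduct (allFin n) (allFin n)))
  where
  ok : Fin n × Fin n → Bool
  ok (u , v) = ⌊ Fin._<?_ u v ⌋ ∧ adj G u v

Connected : ∀ {n} → Graph n → Set
Connected G = ∀ u v → Star (Adj G) u v

-- Triangular faces (vertex triples a < b < c)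

Triangle : ℕ → Set
Triangle n = Fin n × Fin n × Fin n

InFace : ∀ {n} → Triangle n → Fin n → Set
InFace (a , b , c) u = u ≡ a ⊎ u ≡ b ⊎ u ≡ c

inFaceᵇ : ∀ {n} → Triangle n → Fin n → Bool
inFaceᵇ (a , b , c) u = ⌊ u ≟ a ⌋ ∨ ⌊ u ≟ b ⌋ ∨ ⌊ u ≟ c ⌋

IsFace : ∀ {n} → List (Triangle n) → Fin n → Fin n → Fin n → Set
IsFace fs u v w =
  u ≢ v × v ≢ w × u ≢ w × Any (λ t → InFace t u × InFace t v × InFace t w) fs

faceCount : ∀ {n} → List (Triangle n) → Fin n → Fin n → ℕ
faceCount fs u v = length (filterᵇ (λ t → inFaceᵇ t u ∧ inFaceᵇ t v) fs)

-- A 2-cell triangulation embedding, described combinatorially by its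
-- set of (triangular) faces: the faces form a closed connected surface
-- whose 1-skeleton is G.

record TriangulationEmbedding {n : ℕ} (G : Graph n) : Set where
  field
    faces          : List (Triangle n)
    faces-sorted   : All (λ { (a , b , c) → Fin._<_ a b × Fin._<_ b c }) faces
    faces-unique   : Unique faces
    faces-3cycles  : All (λ { (a , b , c) → Adj G a b × Adj G b c × Adj G a c }) faces
    edge-two-faces : ∀ u v → Adj G u v → faceCount faces u v ≡ 2
    -- the link of every vertex is nonempty and connected (hence one cycle)
    link-nonempty  : ∀ v → ∃ λ x → Adj G v x
    link-connected : ∀ v x y → Adj G v x → Adj G v y → Star (IsFace faces v) x y
    connected      : Connected G
open TriangulationEmbedding public

eulerGenus : ∀ {n} {G : Graph n} → TriangulationEmbedding G → ℤ
eulerGenus {n} {G} Π =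
  (((+ 2) ℤ.- (+ n)) ℤ.+ (+ edgeCount G)) ℤ.- (+ length (faces Π))

Consecutive : ∀ {n} → Graph n → List (Fin n) → Set
Consecutive G []           = ⊤
Consecutive G (x ∷ [])     = ⊤
Consecutive G (x ∷ y ∷ xs) = Adj G x y × Consecutive G (y ∷ xs)

closeWalk : ∀ {n} → List (Fin n) → List (Fin n)
closeWalk []       = []
closeWalk (x ∷ xs) = x ∷ xs ++ x ∷ []

IsPath : ∀ {n} → Graph n → List (Fin n) → Set
IsPath G ps = Unique ps × Consecutive G ps

-- a cycle, given by its cyclic sequence of distinct vertices
-- (its length = number of edges = number of vertices)
IsCycle : ∀ {n} → Graph n → List (Fin n) → Set
IsCycle G vs = 3 ≤ length vs × Unique vs × Consecutive G (closeWalk vs)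

-- Elementary homotopies of walks in the 2-complex of the embedding:
-- removing/inserting a backtrack, and pushing an edge across a face.
data HStep {n : ℕ} (G : Graph n) (fs : List (Triangle n)) : List (Fin n) → List (Fin n) → Set where
  backtrack : ∀ xs ys u v → Adj G u v →
              HStep G fs (xs ++ u ∷ v ∷ u ∷ ys) (xs ++ u ∷ ys)
  across    : ∀ xs ys u v w → IsFace fs u v w →
              HStep G fs (xs ++ u ∷ v ∷ ys) (xs ++ u ∷ w ∷ v ∷ ys)

Homotopic : ∀ {n} → (G : Graph n) → TriangulationEmbedding G → List (Fin n) → List (Fin n) → Set
Homotopic G Π = EqClosure (HStep G (faces Π))

Contractible : ∀ {n} → (G : Graph n) → TriangulationEmbedding G → List (Fin n) → Set
Contractible G Π []       = ⊤
Contractible G Π (x ∷ xs) = Homotopic G Π (closeWalk (x ∷ xs)) (x ∷ [])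

NoncontractibleCycle : ∀ {n} → (G : Graph n) → TriangulationEmbedding G → List (Fin n) → Set
NoncontractibleCycle G Π vs = IsCycle G vs × ¬ Contractible G Π vs

IsWidth : ∀ {n} → (G : Graph n) → TriangulationEmbedding G → ℕ → Set
IsWidth G Π w =
  (∃ λ D → NoncontractibleCycle G Π D × length D ≡ w) ×
  (∀ D → NoncontractibleCycle G Π D → w ≤ length D)

ShortestNoncontractibleCycle : ∀ {n} → (G : Graph n) → TriangulationEmbedding G → List (Fin n) → Set
ShortestNoncontractibleCycle G Π C =
  NoncontractibleCycle G Π C × (∀ D → NoncontractibleCycle G Π D → length C ≤ length D)

-- The paths P counted in ncdist(C), indexed by their length.
-- C = c_0 … c_{k-1} (cyclic).  For x = c_i, y = c_j (i < j) the two
-- subpaths of C between x and y have interiors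
--   c_{i+1} … c_{j-1}   and   c_{j+1} … c_{k-1} c_0 … c_{i-1}.

inner₁ : ∀ {A : Set} → List A → ℕ → ℕ → List A
inner₁ C i j = take (j ∸ i ∸ 1) (drop (suc i) C)

inner₂ : ∀ {A : Set} → List A → ℕ → ℕ → List A
inner₂ C i j = drop (suc j) C ++ take i C

data NCPath {n : ℕ} (G : Graph n) (Π : TriangulationEmbedding G) (C : List (Fin n)) : ℕ → Set where
  -- x ≠ y: P = x qs y, and P ∪ C_{x,y}, P ∪ C_{y,x} are noncontractible cycles
  ends : (i j : Fin (length C)) → toℕ i < toℕ j → (qs : List (Fin n)) →
         IsPath G (lookup C i ∷ qs ++ lookup C j ∷ []) →
         NoncontractibleCycle G Π (lookup C i ∷ qs ++ lookup C j ∷ reverse (inner₁ C (toℕ i) (toℕ j))) →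
         NoncontractibleCycle G Π (lookup C i ∷ qs ++ lookup C j ∷ inner₂ C (toℕ i) (toℕ j)) →
         NCPath G Π C (suc (length qs))
  -- x = y: P is a noncontractible cycle through x
  loop : (i : Fin (length C)) → (ps : List (Fin n)) →
         lookup C i ∈ ps → NoncontractibleCycle G Π ps →
         NCPath G Π C (length ps)

module Submission where

-- Let C be a shortest noncontractible cycle, so |C| ≤ w, and let P be a
-- path counted in ncdist(C), of length ℓ.
--  * If P is itself a noncontractible cycle (x = y), then w ≤ ℓ ≤ 2ℓ.
--  * Otherwise P joins c_i and c_j (i < j) and both cycles P ∪ C_{x,y} and
--    P ∪ C_{y,x} are noncontractible, hence each has length ≥ w.  Their
--    lengths are ℓ + 1 + |arc₁| and ℓ + 1 + |arc₂|, where the two open arcs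
--    of C between c_i and c_j together have at most |C| - 2 vertices.
--    Summing, 2w ≤ 2ℓ + |C| ≤ 2ℓ + w, so w ≤ 2ℓ.

open import Defs
open import Data.Nat using (ℕ; _*_; _≤_; suc; _+_; _∸_; _<_)
open import Data.Nat.Properties
open import Data.Integer using (+_) renaming (_≤_ to _≤ℤ_)
open import Data.List using (List; _∷_; _++_; length; take; drop; reverse; lookup)
open import Data.List.Properties using (length-++; length-take; length-drop; length-reverse)
open import Data.Fin using (Fin; toℕ)
open import Data.Fin.Properties using (toℕ<n)
open import Data.Product using (_,_; proj₂)
open import Relation.Binary.PropositionalEquality
open import Data.Nat.Solver using (module +-*-Solver)
open +-*-Solver using (solve; _:+_; _:*_; _:=_; con)

length-closedByPath : ∀ {A : Set} (x y : A) (qs L : List A) →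
  length (x ∷ qs ++ y ∷ L) ≡ 2 + length qs + length L
length-closedByPath x y qs L =
  cong suc (trans (length-++ qs) (+-suc (length qs) (length L)))

-- Index arithmetic behind the arc bound: for i < j < k the two open arcs
-- between positions i and j of a k-cycle have (j-i-1) + (k-j-1+i) = k-2
-- vertices.
arcIndices : ∀ i j k → i < j → j < k → (j ∸ i ∸ 1) + ((k ∸ suc j) + i) + 2 ≡ k
arcIndices i j k i<j j<k = begin
  a + (b + i) + 2       ≡⟨ solve 3 (λ a b i → a :+ (b :+ i) :+ con 2
                                          := b :+ (con 1 :+ (a :+ (con 1 :+ i)))) refl a b i ⟩
  b + suc (a + suc i)   ≡⟨ cong (λ t → b + suc t) a+1+i≡j ⟩
  b + suc j             ≡⟨ m∸n+n≡m j<k ⟩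
  k                     ∎
  where
  open ≡-Reasoning
  a = j ∸ i ∸ 1
  b = k ∸ suc j
  a+1+i≡j : a + suc i ≡ j
  a+1+i≡j = trans (cong (_+ suc i) (∸-+-assoc j i 1))
                  (trans (cong (λ t → j ∸ t + suc i) (+-comm i 1)) (m∸n+n≡m i<j))

arcs-length : ∀ {A : Set} (C : List A) i j → i < j → j < length C →
  length (reverse (inner₁ C i j)) + length (inner₂ C i j) + 2 ≤ length C
arcs-length C i j i<j j<k = begin
  length (reverse (inner₁ C i j)) + length (inner₂ C i j) + 2
    ≤⟨ +-monoˡ-≤ 2 (+-mono-≤ arc₁ arc₂) ⟩
  (j ∸ i ∸ 1) + ((length C ∸ suc j) + i) + 2
    ≡⟨ arcIndices i j (length C) i<j j<k ⟩
  length C ∎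
  where
  open ≤-Reasoning
  arc₁ : length (reverse (inner₁ C i j)) ≤ j ∸ i ∸ 1
  arc₁ rewrite length-reverse (inner₁ C i j)
             | length-take (j ∸ i ∸ 1) (drop (suc i) C) = m⊓n≤m _ _
  arc₂ : length (inner₂ C i j) ≤ (length C ∸ suc j) + i
  arc₂ rewrite length-++ (drop (suc j) C) {take i C}
             | length-drop (suc j) C | length-take i C =
    +-monoʳ-≤ (length C ∸ suc j) (m⊓n≤m i (length C))

shortest≤width : ∀ {n} (G : Graph n) (Π : TriangulationEmbedding G) (w : ℕ) →
  IsWidth G Π w → (C : List (Fin n)) → ShortestNoncontractibleCycle G Π C →
  length C ≤ w
shortest≤width G Π w ((D , Dnc , refl) , _) C (_ , Cmin) = Cmin D Dnc

averaging : ∀ w a b₁ b₂ → w ≤ 2 + a + b₁ → w ≤ 2 + a + b₂ →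
  b₁ + b₂ + 2 ≤ w → w ≤ 2 * suc a
averaging w a b₁ b₂ h₁ h₂ h = +-cancelʳ-≤ w w (2 * suc a) (begin
  w + w                         ≤⟨ +-mono-≤ h₁ h₂ ⟩
  (2 + a + b₁) + (2 + a + b₂)   ≡⟨ solve 3 (λ a b₁ b₂ → (con 2 :+ a :+ b₁) :+ (con 2 :+ a :+ b₂)
                                         := (b₁ :+ b₂ :+ con 2) :+ con 2 :* (con 1 :+ a)) refl a b₁ b₂ ⟩
  (b₁ + b₂ + 2) + 2 * suc a     ≤⟨ +-monoˡ-≤ (2 * suc a) h ⟩
  w + 2 * suc a                 ≡⟨ +-comm w _ ⟩
  2 * suc a + w                 ∎)
  where open ≤-Reasoning

proposition1 : ∀ {n} (G : Graph n) (Π : TriangulationEmbedding G) →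
    + 1 ≤ℤ eulerGenus Π →
    (w : ℕ) → IsWidth G Π w →
    (C : List (Fin n)) → ShortestNoncontractibleCycle G Π C →
    ∀ ℓ → NCPath G Π C ℓ → w ≤ 2 * ℓ
proposition1 G Π _ w (_ , wmin) C _ .(length ps) (loop i ps _ nc) =
  ≤-trans (wmin ps nc) (m≤m+n (length ps) _)
proposition1 G Π _ w width C shortest .(suc (length qs)) (ends i j i<j qs _ nc₁ nc₂) =
  averaging w (length qs) (length L₁) (length L₂)
    (cycleThrough L₁ nc₁) (cycleThrough L₂ nc₂)
    (≤-trans (arcs-length C (toℕ i) (toℕ j) i<j (toℕ<n j))
             (shortest≤width G Π w width C shortest))
  where
  x = lookup C i
  y = lookup C j
  L₁ = reverse (inner₁ C (toℕ i) (toℕ j))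
  L₂ = inner₂ C (toℕ i) (toℕ j)
  cycleThrough : ∀ L → NoncontractibleCycle G Π (x ∷ qs ++ y ∷ L) →
    w ≤ 2 + length qs + length L
  cycleThrough L nc =
    subst (w ≤_) (length-closedByPath x y qs L) (proj₂ width _ nc)
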